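{- For every integer $n\ge2$, $$\min_{\Gamma\in\mathfrak{G}^{NN}_n}m^\Gamma_\land=2,$$ where $\mathfrak{G}^{NN}_n$ is the class of (isomorphism classes of) graphs with $n$ nodes, positive minimum out-degree and positive minimum in-degree.
   Context: A graph $\Gamma$ is a finite simple directed graph with node set $\mathcal{V}(\Gamma)$ and out-neighbour sets $\Gamma^+(v)$ (loops allowed, multiple arcs not). $S^\Gamma_\land(\mathbf{x})=\sum_{v:\Gamma^+(v)\ne\emptyset}x_v/\min_{w\in\Gamma^+(v)}x_w$ for admissible $\mathbf{x}\in[0,\infty)^{\mathcal{V}(\Gamma)}$ ($\mathbf{x}\ne0$ and the $v$-th denominator nonzero whenever $x_v=0$; $a/0=+\infty$ for $a>0$), and $m^\Gamma_\land$ is its infimum.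
   Formalization: The admissible vectors $\mathbf{x}$ have entries in the nonnegative rationals rather than in $[0,\infty)$. -}

module Defs where

open import Data.Bool using (Bool; true; false; if_then_else_)
open import Data.Fin using (Fin)
open import Data.List using (List; foldr)
open import Data.List using (allFin)
open import Data.Maybe using (Maybe; just; nothing)
open import Data.Nat using (ℕ)
open import Data.Product using (Σ; _×_; ∃)
open import Data.Integer using ()
open import Data.Rational using (ℚ; 0ℚ; _<_; _≤_; _+_; _÷_; _⊓_; positive)
open import Data.Rational.Properties using (_<?_; pos⇒nonZero)
open import Relation.Binary.PropositionalEquality using (_≡_)
open import Relation.Nullary using (¬_; yes; no)

-- A finite simple directed graph (loops allowed, no multiple arcs) on the
-- node set Fin n, given by its arc relation: adj v w ≡ true iff v → w.
record Graph (n : ℕ) : Set where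
  field
    adj : Fin n → Fin n → Bool
open Graph public

data ℚ∞ : Set where
  fin : ℚ → ℚ∞
  ∞   : ℚ∞

_+∞_ : ℚ∞ → ℚ∞ → ℚ∞
fin a +∞ fin b = fin (a + b)
fin _ +∞ ∞     = ∞
∞     +∞ _     = ∞

data _≤∞_ : ℚ∞ → ℚ∞ → Set where
  fin≤fin : ∀ {a b} → a ≤ b → fin a ≤∞ fin b
  x≤∞     : ∀ {a} → a ≤∞ ∞

data _<∞_ : ℚ∞ → ℚ∞ → Set where
  fin<fin : ∀ {a b} → a < b → fin a <∞ fin b
  fin<∞   : ∀ {a} → fin a <∞ ∞

minOver : ∀ {n} → (Fin n → ℚ) → List (Fin n) → Maybe ℚ
minOver x = foldr step nothing
  where
  step : _ → Maybe ℚ → Maybe ℚ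
  step w nothing  = just (x w)
  step w (just m) = just (x w ⊓ m)

outNbrs : ∀ {n} → Graph n → Fin n → List (Fin n)
outNbrs {n} Γ v = foldr (λ w ws → if adj Γ v w then w Data.List.∷ ws else ws) Data.List.[] (allFin n)

minOut : ∀ {n} → Graph n → (Fin n → ℚ) → Fin n → Maybe ℚ
minOut Γ x v = minOver x (outNbrs Γ v)

-- The quotient a / m with the convention a/0 = +∞ for a > 0.
-- (The case a = m = 0 is excluded by admissibility; its value is irrelevant.)
ratio : ℚ → ℚ → ℚ∞
ratio a m with 0ℚ <? m
... | yes m>0 = fin ((a ÷ m) {{pos⇒nonZero m {{positive m>0}}}})
... | no  _   = ∞

term : ∀ {n} → Graph n → (Fin n → ℚ) → Fin n → ℚ∞
term Γ x v with minOut Γ x v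
... | nothing = fin 0ℚ
... | just m  = ratio (x v) m

S∧ : ∀ {n} → Graph n → (Fin n → ℚ) → ℚ∞
S∧ {n} Γ x = foldr (λ v acc → term Γ x v +∞ acc) (fin 0ℚ) (allFin n)

Admissible : ∀ {n} → Graph n → (Fin n → ℚ) → Set
Admissible Γ x =
  (∀ v → 0ℚ ≤ x v) ×
  (¬ (∀ v → x v ≡ 0ℚ)) ×
  (∀ v m → minOut Γ x v ≡ just m → x v ≡ 0ℚ → ¬ (m ≡ 0ℚ))

InfEq : ∀ {n} → Graph n → ℚ → Set
InfEq Γ c =
  (∀ x → Admissible Γ x → fin c ≤∞ S∧ Γ x) ×
  (∀ ε → 0ℚ < ε → Σ _ λ x → Admissible Γ x × (S∧ Γ x <∞ fin (c + ε)))

InfGE : ∀ {n} → Graph n → ℚ → Set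
InfGE Γ c = ∀ x → Admissible Γ x → fin c ≤∞ S∧ Γ x

NN : ∀ {n} → Graph n → Set
NN Γ = (∀ v → ∃ λ w → adj Γ v w ≡ true) × (∀ w → ∃ λ v → adj Γ v w ≡ true)

2ℚ : ℚ
2ℚ = Data.Rational._/_ (Data.Integer.+ 2) 1

{-# OPTIONS --safe #-}
-- Let u maximise and w minimise x ≥ 0, and let v be an in-neighbour of w.  A node with an
-- out-neighbour of no larger value contributes at least 1 to S∧, so u does, and so does v;
-- if v ≠ u this gives 2.  If v = u then u → w, so u contributes at least x_u / x_w, while any
-- other node z contributes at least x_z / x_u ≥ x_w / x_u, and a/b + b/a ≥ 2.
-- Conversely the graph `extremal` has S∧ ≤ 2 + (n − 2) δ at (1, δ, …, δ), for every δ > 0.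
module Submission where

open import Defs
open import Data.Nat using (ℕ; _≤_)
open import Data.Product using (Σ; _×_)
open import Data.Rational using (ℚ)

open import Algebra.Bundles using (CommutativeRing)
open import Data.Bool using (true; false; if_then_else_)
open import Data.Empty using (⊥-elim)
open import Data.Fin using (Fin; zero; suc; punchIn; _≟_)
open import Data.Fin.Properties using (punchInᵢ≢i)
open import Data.List using (List; []; _∷_; foldr; allFin; tabulate)
open import Data.List.Membership.Propositional using (_∈_)
open import Data.List.Membership.Propositional.Properties using (∈-allFin)
open import Data.List.Relation.Unary.All as All using ()
open import Data.List.Relation.Unary.Any using (here; there)
open import Data.Maybe using (just; nothing)
open import Data.Nat using (suc; zero; s≤s; z≤n)
open import Data.Product using (_,_; proj₁; proj₂; ∃)
open import Data.Rational
  using (0ℚ; 1ℚ; _+_; _*_; -_; _-_; _÷_; _⊓_; 1/_; NonZero; >-nonZero; positive; nonNegative)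
  renaming (_≤_ to _≤ℚ_; _<_ to _<ℚ_)
open import Data.Rational.Properties hiding (_≟_)
open import Data.Rational.Solver using (module +-*-Solver)
open import Function using (_∘_)
open import Relation.Binary.Bundles using (DecTotalOrder)
open import Relation.Binary.PropositionalEquality
open import Relation.Nullary using (Dec; yes; no; contradiction)

open import Algebra.Properties.Semiring.Mult (CommutativeRing.semiring +-*-commutativeRing)
  using (×-assoc-*) renaming (_×_ to _·_)
open import Data.List.Extrema (DecTotalOrder.totalOrder ≤-decTotalOrder)
  using (argmax; argmin; f[xs]≤f[argmax]; f[argmin]≤f[xs])

open +-*-Solver using (solve; _:+_; _:*_; _:-_; con; _:=_)

module _ {m : ℚ} (m>0 : 0ℚ <ℚ m) where
  private instance
    m≢0 : NonZero m
    m≢0 = pos⇒nonZero m {{positive m>0}}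

  ÷-*-cancel : ∀ a → (a ÷ m) * m ≡ a
  ÷-*-cancel a = begin
    a * 1/ m * m    ≡⟨ *-assoc a (1/ m) m ⟩
    a * (1/ m * m)  ≡⟨ cong (a *_) (*-inverseˡ m) ⟩
    a * 1ℚ          ≡⟨ *-identityʳ a ⟩
    a               ∎
    where open ≡-Reasoning

  *≤⇒≤÷ : ∀ {q a} → q * m ≤ℚ a → q ≤ℚ a ÷ m
  *≤⇒≤÷ {q} {a} q*m≤a =
    *-cancelʳ-≤-pos m {{positive m>0}} (subst (q * m ≤ℚ_) (sym (÷-*-cancel a)) q*m≤a)

  ≤*⇒÷≤ : ∀ {q a} → a ≤ℚ q * m → a ÷ m ≤ℚ q
  ≤*⇒÷≤ {q} {a} a≤q*m =
    *-cancelʳ-≤-pos m {{positive m>0}} (subst (_≤ℚ q * m) (sym (÷-*-cancel a)) a≤q*m)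

  ÷-nonNeg : ∀ {a} → 0ℚ ≤ℚ a → 0ℚ ≤ℚ a ÷ m
  ÷-nonNeg {a} a≥0 = *≤⇒≤÷ (subst (_≤ℚ a) (sym (*-zeroˡ m)) a≥0)

  ÷-pos : ∀ {a} → 0ℚ <ℚ a → 0ℚ <ℚ a ÷ m
  ÷-pos {a} a>0 =
    positive⁻¹ _ {{pos*pos⇒pos a {{positive a>0}} _ {{1/pos⇒pos m {{positive m>0}}}}}}

÷-*-÷-inverse : ∀ a b .{{_ : NonZero a}} .{{_ : NonZero b}} → (a ÷ b) * (b ÷ a) ≡ 1ℚ
÷-*-÷-inverse a b = begin
  a * 1/ b * (b * 1/ a)      ≡⟨ solve 4 (λ a b a⁻¹ b⁻¹ → a :* b⁻¹ :* (b :* a⁻¹) := a :* a⁻¹ :* (b :* b⁻¹))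
                                        refl a b (1/ a) (1/ b) ⟩
  a * 1/ a * (b * 1/ b)      ≡⟨ cong₂ _*_ (*-inverseʳ a) (*-inverseʳ b) ⟩
  1ℚ                         ∎
  where open ≡-Reasoning

p*q≡1⇒2≤p+q : ∀ {p q} → 1ℚ ≤ℚ p → q ≤ℚ 1ℚ → p * q ≡ 1ℚ → 2ℚ ≤ℚ p + q
p*q≡1⇒2≤p+q {p} {q} 1≤p q≤1 p*q≡1 = begin
  2ℚ                         ≡⟨ cong (_+ 1ℚ) (sym p*q≡1) ⟩
  p * q + 1ℚ                 ≡⟨ solve 2 (λ p q → p :* q :+ con 1ℚ := (p :- con 1ℚ) :* q :+ (q :+ con 1ℚ))
                                        refl p q ⟩
  (p - 1ℚ) * q + (q + 1ℚ)    ≤⟨ +-monoˡ-≤ (q + 1ℚ) (*-monoˡ-≤-nonNeg (p - 1ℚ) {{nonNegative p-1≥0}} q≤1) ⟩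
  (p - 1ℚ) * 1ℚ + (q + 1ℚ)   ≡⟨ solve 2 (λ p q → (p :- con 1ℚ) :* con 1ℚ :+ (q :+ con 1ℚ) := p :+ q)
                                        refl p q ⟩
  p + q                      ∎
  where
  open ≤-Reasoning
  p-1≥0 : 0ℚ ≤ℚ p - 1ℚ
  p-1≥0 = +-monoˡ-≤ (- 1ℚ) 1≤p

≤∞-refl : ∀ {a} → a ≤∞ a
≤∞-refl {fin a} = fin≤fin ≤-refl
≤∞-refl {∞}     = x≤∞

≤∞-trans : ∀ {a b c} → a ≤∞ b → b ≤∞ c → a ≤∞ c
≤∞-trans (fin≤fin a≤b) (fin≤fin b≤c) = fin≤fin (≤-trans a≤b b≤c)
≤∞-trans (fin≤fin _)   x≤∞           = x≤∞
≤∞-trans x≤∞           x≤∞           = x≤∞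

≤∞-<-trans : ∀ {a b c} → a ≤∞ fin b → b <ℚ c → a <∞ fin c
≤∞-<-trans (fin≤fin a≤b) b<c = fin<fin (≤-<-trans a≤b b<c)

+∞-comm : ∀ a b → (a +∞ b) ≡ (b +∞ a)
+∞-comm (fin a) (fin b) = cong fin (+-comm a b)
+∞-comm (fin _) ∞       = refl
+∞-comm ∞       (fin _) = refl
+∞-comm ∞       ∞       = refl

+∞-mono-≤∞ : ∀ {a a′ b b′} → a ≤∞ a′ → b ≤∞ b′ → (a +∞ b) ≤∞ (a′ +∞ b′)
+∞-mono-≤∞ (fin≤fin a≤a′) (fin≤fin b≤b′) = fin≤fin (+-mono-≤ a≤a′ b≤b′)
+∞-mono-≤∞ (fin≤fin _)    x≤∞            = x≤∞
+∞-mono-≤∞ x≤∞            _              = x≤∞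

x≤∞x+∞y : ∀ x {y} → fin 0ℚ ≤∞ y → x ≤∞ (x +∞ y)
x≤∞x+∞y (fin x) (fin≤fin y≥0) =
  fin≤fin (subst (_≤ℚ x + _) (+-identityʳ x) (+-monoʳ-≤ x y≥0))
x≤∞x+∞y (fin _) x≤∞ = x≤∞
x≤∞x+∞y ∞       _   = x≤∞

x≤∞y+∞x : ∀ x {y} → fin 0ℚ ≤∞ y → x ≤∞ (y +∞ x)
x≤∞y+∞x x {y} y≥0 = subst (x ≤∞_) (+∞-comm x y) (x≤∞x+∞y x y≥0)

sum∞ : ∀ {A : Set} → (A → ℚ∞) → List A → ℚ∞
sum∞ f = foldr (λ a acc → f a +∞ acc) (fin 0ℚ)

module _ {A : Set} (f : A → ℚ∞) (f≥0 : ∀ a → fin 0ℚ ≤∞ f a) where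

  sum∞-nonNeg : ∀ xs → fin 0ℚ ≤∞ sum∞ f xs
  sum∞-nonNeg []       = fin≤fin ≤-refl
  sum∞-nonNeg (a ∷ xs) = +∞-mono-≤∞ (f≥0 a) (sum∞-nonNeg xs)

  ∈⇒≤sum∞ : ∀ {a xs} → a ∈ xs → f a ≤∞ sum∞ f xs
  ∈⇒≤sum∞ {xs = a ∷ xs} (here refl) = x≤∞x+∞y (f a) (sum∞-nonNeg xs)
  ∈⇒≤sum∞ {xs = b ∷ xs} (there a∈xs) = ≤∞-trans (∈⇒≤sum∞ a∈xs) (x≤∞y+∞x _ (f≥0 b))

  ∈∈⇒≤sum∞ : ∀ {a b xs} → a ≢ b → a ∈ xs → b ∈ xs → (f a +∞ f b) ≤∞ sum∞ f xs
  ∈∈⇒≤sum∞ a≢b (here refl) (here refl) = ⊥-elim (a≢b refl)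
  ∈∈⇒≤sum∞ a≢b (here refl) (there b∈xs) = +∞-mono-≤∞ ≤∞-refl (∈⇒≤sum∞ b∈xs)
  ∈∈⇒≤sum∞ {a} {b} {c ∷ xs} a≢b (there a∈xs) (here refl) =
    subst (_≤∞ (f c +∞ sum∞ f xs)) (+∞-comm (f c) (f a)) (+∞-mono-≤∞ ≤∞-refl (∈⇒≤sum∞ a∈xs))
  ∈∈⇒≤sum∞ {xs = c ∷ xs} a≢b (there a∈xs) (there b∈xs) =
    ≤∞-trans (∈∈⇒≤sum∞ a≢b a∈xs b∈xs) (x≤∞y+∞x _ (f≥0 c))

sum∞-tabulate-≤ : ∀ {A : Set} {k} (f : A → ℚ∞) (g : Fin k → A) {d} →
                  (∀ i → f (g i) ≤∞ fin d) → sum∞ f (tabulate g) ≤∞ fin (k · d)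
sum∞-tabulate-≤ {k = zero}  f g f≤d = fin≤fin ≤-refl
sum∞-tabulate-≤ {k = suc k} f g f≤d =
  +∞-mono-≤∞ (f≤d zero) (sum∞-tabulate-≤ f (g ∘ suc) (f≤d ∘ suc))

-- ratio a m = ∞ whenever m ≤ 0, even for a = 0; this spares most positivity hypotheses below.
0≤ratio : ∀ {a m} → 0ℚ ≤ℚ a → fin 0ℚ ≤∞ ratio a m
0≤ratio {a} {m} a≥0 with 0ℚ <? m
... | yes m>0 = fin≤fin (÷-nonNeg m>0 a≥0)
... | no  _   = x≤∞

1≤ratio : ∀ {a m} → m ≤ℚ a → fin 1ℚ ≤∞ ratio a m
1≤ratio {a} {m} m≤a with 0ℚ <? m
... | yes m>0 = fin≤fin (*≤⇒≤÷ m>0 (subst (_≤ℚ a) (sym (*-identityˡ m)) m≤a))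
... | no  _   = x≤∞

ratio-≤ : ∀ {a m q} → 0ℚ <ℚ m → a ≤ℚ q * m → ratio a m ≤∞ fin q
ratio-≤ {a} {m} m>0 a≤q*m with 0ℚ <? m
... | yes m>0′ = fin≤fin (≤*⇒÷≤ m>0′ a≤q*m)
... | no  m≯0  = contradiction m>0 m≯0

ratio-mono : ∀ {a a′ m m′} → 0ℚ ≤ℚ a → a ≤ℚ a′ → m′ ≤ℚ m → ratio a m ≤∞ ratio a′ m′
ratio-mono {a} {a′} {m} {m′} a≥0 a≤a′ m′≤m with 0ℚ <? m | 0ℚ <? m′
... | _       | no  _    = x≤∞
... | no  m≯0 | yes m′>0 = contradiction (<-≤-trans m′>0 m′≤m) m≯0
... | yes m>0 | yes m′>0 = fin≤fin (*≤⇒≤÷ m′>0 (begin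
  (a ÷ m) * m′  ≤⟨ *-monoˡ-≤-nonNeg (a ÷ m) {{nonNegative (÷-nonNeg m>0 a≥0)}} m′≤m ⟩
  (a ÷ m) * m   ≡⟨ ÷-*-cancel m>0 a ⟩
  a             ≤⟨ a≤a′ ⟩
  a′            ∎))
  where
  open ≤-Reasoning
  instance
    m≢0 : NonZero m
    m≢0 = pos⇒nonZero m {{positive m>0}}

ratio+ratio≥2 : ∀ {a b} → b ≤ℚ a → fin 2ℚ ≤∞ (ratio a b +∞ ratio b a)
ratio+ratio≥2 {a} {b} b≤a with 0ℚ <? b | 0ℚ <? a
... | no  _   | _       = x≤∞
... | yes b>0 | no  a≯0 = contradiction (<-≤-trans b>0 b≤a) a≯0
... | yes b>0 | yes a>0 = fin≤fin (p*q≡1⇒2≤p+q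
  (*≤⇒≤÷ b>0 (subst (_≤ℚ a) (sym (*-identityˡ b)) b≤a))
  (≤*⇒÷≤ a>0 (subst (b ≤ℚ_) (sym (*-identityˡ a)) b≤a))
  (÷-*-÷-inverse a b {{>-nonZero a>0}} {{>-nonZero b>0}}))

module _ {n} (x : Fin n → ℚ) where

  minOver-≤ : ∀ {y xs} → y ∈ xs → ∃ λ m → minOver x xs ≡ just m × m ≤ℚ x y
  minOver-≤ {xs = z ∷ xs} (here refl) with minOver x xs
  ... | nothing = x z , refl , ≤-refl
  ... | just m  = x z ⊓ m , refl , p⊓q≤p (x z) m
  minOver-≤ {xs = z ∷ xs} (there y∈xs) with minOver x xs | minOver-≤ y∈xs
  ... | just m | .m , refl , m≤y = x z ⊓ m , refl , ≤-trans (p⊓q≤q (x z) m) m≤y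

  minOver-glb : ∀ {lo m} xs → (∀ {z} → z ∈ xs → lo ≤ℚ x z) → minOver x xs ≡ just m → lo ≤ℚ m
  minOver-glb (z ∷ xs) lo≤ eq with minOver x xs in eq′
  minOver-glb (z ∷ xs) lo≤ refl | nothing = lo≤ (here refl)
  minOver-glb (z ∷ xs) lo≤ refl | just m  =
    ⊓-glb (lo≤ (here refl)) (minOver-glb xs (lo≤ ∘ there) eq′)

module _ {n} (Γ : Graph n) (v : Fin n) where

  private
    outNbrsIn : List (Fin n) → List (Fin n)
    outNbrsIn = foldr (λ w ws → if adj Γ v w then w ∷ ws else ws) []

    outNbrsIn⁺ : ∀ {y} xs → y ∈ xs → adj Γ v y ≡ true → y ∈ outNbrsIn xs
    outNbrsIn⁺ (y ∷ xs) (here refl) v→y rewrite v→y = here refl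
    outNbrsIn⁺ (z ∷ xs) (there y∈xs) v→y with adj Γ v z
    ... | true  = there (outNbrsIn⁺ xs y∈xs v→y)
    ... | false = outNbrsIn⁺ xs y∈xs v→y

    outNbrsIn⁻ : ∀ {y} xs → y ∈ outNbrsIn xs → adj Γ v y ≡ true
    outNbrsIn⁻ (z ∷ xs) y∈ with adj Γ v z in v→z
    outNbrsIn⁻ (z ∷ xs) (here refl)  | true  = v→z
    outNbrsIn⁻ (z ∷ xs) (there y∈)   | true  = outNbrsIn⁻ xs y∈
    outNbrsIn⁻ (z ∷ xs) y∈           | false = outNbrsIn⁻ xs y∈

  ∈-outNbrs⁺ : ∀ {y} → adj Γ v y ≡ true → y ∈ outNbrs Γ v
  ∈-outNbrs⁺ {y} = outNbrsIn⁺ (allFin n) (∈-allFin y)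

  ∈-outNbrs⁻ : ∀ {y} → y ∈ outNbrs Γ v → adj Γ v y ≡ true
  ∈-outNbrs⁻ = outNbrsIn⁻ (allFin n)

module _ {n} (Γ : Graph n) (x : Fin n → ℚ) where

  term-nonNeg : ∀ {v} → 0ℚ ≤ℚ x v → fin 0ℚ ≤∞ term Γ x v
  term-nonNeg {v} x≥0 with minOut Γ x v
  ... | nothing = fin≤fin ≤-refl
  ... | just _  = 0≤ratio x≥0

  ratio≤term : ∀ {v y} → 0ℚ ≤ℚ x v → adj Γ v y ≡ true → ratio (x v) (x y) ≤∞ term Γ x v
  ratio≤term {v} x≥0 v→y with minOut Γ x v | minOver-≤ x (∈-outNbrs⁺ Γ v v→y)
  ... | just m | .m , refl , m≤y = ratio-mono x≥0 ≤-refl m≤y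

  term≤ratio : ∀ {v lo} → 0ℚ ≤ℚ x v → (∀ {y} → adj Γ v y ≡ true → lo ≤ℚ x y) →
               term Γ x v ≤∞ ratio (x v) lo
  term≤ratio {v} x≥0 lo≤ with minOut Γ x v in eq
  ... | nothing = 0≤ratio x≥0
  ... | just m  = ratio-mono x≥0 ≤-refl (minOver-glb x (outNbrs Γ v) (lo≤ ∘ ∈-outNbrs⁻ Γ v) eq)

  1≤term : ∀ {v y} → 0ℚ ≤ℚ x v → adj Γ v y ≡ true → x y ≤ℚ x v → fin 1ℚ ≤∞ term Γ x v
  1≤term x≥0 v→y y≤v = ≤∞-trans (1≤ratio y≤v) (ratio≤term x≥0 v→y)

  term+term≤S∧ : (∀ v → 0ℚ ≤ℚ x v) → ∀ {a b} → a ≢ b → (term Γ x a +∞ term Γ x b) ≤∞ S∧ Γ x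
  term+term≤S∧ x≥0 a≢b = ∈∈⇒≤sum∞ (term Γ x) (term-nonNeg ∘ x≥0) a≢b (∈-allFin _) (∈-allFin _)

module _ {k} (Γ : Graph (suc (suc k))) (Γ∈NN : NN Γ) (x : Fin (suc (suc k)) → ℚ)
         (x≥0 : ∀ v → 0ℚ ≤ℚ x v) where

  private
    u w : Fin (suc (suc k))
    u = argmax x zero (allFin _)
    w = argmin x zero (allFin _)

    x≤xu : ∀ y → x y ≤ℚ x u
    x≤xu y = All.lookup (f[xs]≤f[argmax] {f = x} zero (allFin _)) (∈-allFin y)

    xw≤x : ∀ y → x w ≤ℚ x y
    xw≤x y = All.lookup (f[argmin]≤f[xs] {f = x} zero (allFin _)) (∈-allFin y)

    1≤term-u : fin 1ℚ ≤∞ term Γ x u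
    1≤term-u = 1≤term Γ x (x≥0 u) (proj₂ (proj₁ Γ∈NN u)) (x≤xu _)

    -- a `with` on v ≟ u here would make Agda normalise S∧ Γ x, which takes minutes
    S∧≥2-by-cases : ∀ v → adj Γ v w ≡ true → Dec (v ≡ u) → fin 2ℚ ≤∞ S∧ Γ x
    S∧≥2-by-cases v v→w (no v≢u) = ≤∞-trans
      (+∞-mono-≤∞ 1≤term-u (1≤term Γ x (x≥0 v) v→w (xw≤x v)))
      (term+term≤S∧ Γ x x≥0 (v≢u ∘ sym))
    S∧≥2-by-cases v u→w (yes refl) = ≤∞-trans
      (≤∞-trans (ratio+ratio≥2 (xw≤x u)) (+∞-mono-≤∞ (ratio≤term Γ x (x≥0 u) u→w) ratio≤term-z))
      (term+term≤S∧ Γ x x≥0 (punchInᵢ≢i u zero ∘ sym))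
      where
      z = punchIn u zero
      ratio≤term-z : ratio (x w) (x u) ≤∞ term Γ x z
      ratio≤term-z = ≤∞-trans (ratio-mono (x≥0 w) (xw≤x z) (x≤xu _))
                              (ratio≤term Γ x (x≥0 z) (proj₂ (proj₁ Γ∈NN z)))

  S∧≥2 : fin 2ℚ ≤∞ S∧ Γ x
  S∧≥2 = S∧≥2-by-cases _ (proj₂ (proj₂ Γ∈NN w)) (_ ≟ u)

·-nonNeg : ∀ n {p} → 0ℚ ≤ℚ p → 0ℚ ≤ℚ n · p
·-nonNeg zero    _   = ≤-refl
·-nonNeg (suc n) p≥0 = +-mono-≤ p≥0 (·-nonNeg n p≥0)

∃δ>0[k·δ<ε] : ∀ k {ε} → 0ℚ <ℚ ε → ∃ λ δ → 0ℚ <ℚ δ × k · δ <ℚ ε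
∃δ>0[k·δ<ε] k {ε} ε>0 = δ , δ>0 , (begin-strict
  k · δ            ≡⟨ sym (+-identityˡ (k · δ)) ⟩
  0ℚ + k · δ       <⟨ +-monoˡ-< (k · δ) δ>0 ⟩
  suc k · δ        ≡⟨ cong (suc k ·_) (sym (*-identityˡ δ)) ⟩
  suc k · (1ℚ * δ) ≡⟨ sym (×-assoc-* (suc k) 1ℚ δ) ⟩
  c * δ            ≡⟨ *-comm c δ ⟩
  δ * c            ≡⟨ ÷-*-cancel c>0 ε ⟩
  ε                ∎)
  where
  open ≤-Reasoning
  c = suc k · 1ℚ
  c>0 : 0ℚ <ℚ c
  c>0 = +-mono-<-≤ (positive⁻¹ 1ℚ) (·-nonNeg k (nonNegative⁻¹ 1ℚ))
  δ = (ε ÷ c) {{pos⇒nonZero c {{positive c>0}}}}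
  δ>0 = ÷-pos c>0 ε>0

pos⇒admissible : ∀ {n} (Γ : Graph (suc n)) {x} → (∀ v → 0ℚ <ℚ x v) → Admissible Γ x
pos⇒admissible Γ x>0 =
  <⇒≤ ∘ x>0 ,
  (λ x≡0 → <-irrefl (sym (x≡0 zero)) (x>0 zero)) ,
  (λ v _ _ xv≡0 _ → <-irrefl (sym xv≡0) (x>0 v))

extremal : ∀ k → Graph (suc (suc k))
adj (extremal k) zero          zero    = true
adj (extremal k) zero          (suc _) = false
adj (extremal k) (suc zero)    zero    = false
adj (extremal k) (suc zero)    (suc _) = true
adj (extremal k) (suc (suc _)) zero    = true
adj (extremal k) (suc (suc _)) (suc _) = false

extremal∈NN : ∀ k → NN (extremal k)
extremal∈NN k = out , in′
  where
  out : ∀ v → ∃ λ w → adj (extremal k) v w ≡ true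
  out zero          = zero , refl
  out (suc zero)    = suc zero , refl
  out (suc (suc _)) = zero , refl
  in′ : ∀ w → ∃ λ v → adj (extremal k) v w ≡ true
  in′ zero    = zero , refl
  in′ (suc _) = suc zero , refl

module _ (k : ℕ) {δ : ℚ} (δ>0 : 0ℚ <ℚ δ) where

  probe : Fin (suc (suc k)) → ℚ
  probe zero    = 1ℚ
  probe (suc _) = δ

  probe>0 : ∀ v → 0ℚ <ℚ probe v
  probe>0 zero    = positive⁻¹ 1ℚ
  probe>0 (suc _) = δ>0

  private
    term≤ : ∀ v lo q → 0ℚ <ℚ lo → probe v ≤ℚ q * lo →
            (∀ {y} → adj (extremal k) v y ≡ true → lo ≤ℚ probe y) → term (extremal k) probe v ≤∞ fin q
    term≤ v lo q lo>0 v≤q*lo lo≤ =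
      ≤∞-trans (term≤ratio (extremal k) probe (<⇒≤ (probe>0 v)) lo≤) (ratio-≤ lo>0 v≤q*lo)

  S∧-probe-≤ : S∧ (extremal k) probe ≤∞ fin (1ℚ + (1ℚ + k · δ))
  S∧-probe-≤ = +∞-mono-≤∞ term₀≤1 (+∞-mono-≤∞ term₁≤1
    (sum∞-tabulate-≤ (term (extremal k) probe) (λ i → suc (suc i)) term₂₊≤δ))
    where
    term₀≤1 : term (extremal k) probe zero ≤∞ fin 1ℚ
    term₀≤1 = term≤ zero 1ℚ 1ℚ (positive⁻¹ 1ℚ) ≤-refl λ { {zero} _ → ≤-refl }
    term₁≤1 : term (extremal k) probe (suc zero) ≤∞ fin 1ℚ
    term₁≤1 = term≤ (suc zero) δ 1ℚ δ>0 (≤-reflexive (sym (*-identityˡ δ))) λ { {suc _} _ → ≤-refl }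
    term₂₊≤δ : ∀ i → term (extremal k) probe (suc (suc i)) ≤∞ fin δ
    term₂₊≤δ i = term≤ (suc (suc i)) 1ℚ δ (positive⁻¹ 1ℚ) (≤-reflexive (sym (*-identityʳ δ)))
                   λ { {zero} _ → ≤-refl }

extremal-approx : ∀ k ε → 0ℚ <ℚ ε →
                  Σ _ λ x → Admissible (extremal k) x × S∧ (extremal k) x <∞ fin (2ℚ + ε)
extremal-approx k ε ε>0 =
  let δ , δ>0 , k·δ<ε = ∃δ>0[k·δ<ε] k ε>0 in
  probe k δ>0 , pos⇒admissible (extremal k) (probe>0 k δ>0) ,
  ≤∞-<-trans (S∧-probe-≤ k δ>0) (begin-strict
    1ℚ + (1ℚ + k · δ)   ≡⟨ sym (+-assoc 1ℚ 1ℚ (k · δ)) ⟩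
    2ℚ + k · δ          <⟨ +-monoʳ-< 2ℚ k·δ<ε ⟩
    2ℚ + ε              ∎)
  where open ≤-Reasoning

proposition8 : (n : ℕ) → 2 ≤ n →
    ((Γ : Graph n) → NN Γ → InfGE Γ 2ℚ)
    × Σ (Graph n) (λ Γ → NN Γ × InfEq Γ 2ℚ)
proposition8 (suc (suc k)) (s≤s (s≤s z≤n)) =
  m∧≥2 , extremal k , extremal∈NN k , m∧≥2 (extremal k) (extremal∈NN k) , extremal-approx k
  where
  m∧≥2 : (Γ : Graph (suc (suc k))) → NN Γ → InfGE Γ 2ℚ
  m∧≥2 Γ Γ∈NN x (x≥0 , _) = S∧≥2 Γ Γ∈NN x x≥0
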